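{- For every $n\ge1$ and $r\geq 1$, the $r$-independence complex $\mathrm{Ind}_r(P_n)$ of the path graph $P_n$ on $n$ vertices is vertex decomposable.
   Context: For $r\ge1$, a subset $A\subseteq V(G)$ is $r$-independent if every connected component of the induced subgraph $G[A]$ has at most $r$ vertices; $\mathrm{Ind}_r(G)$ is the simplicial complex on $V(G)$ whose faces are the $r$-independent subsets. For a simplicial complex $\mathcal K$ and vertex $x$, $\mathrm{lk}_{\mathcal K}(x)=\{F\in\mathcal K: x\notin F,\ F\cup\{x\}\in\mathcal K\}$ and $\mathrm{del}_{\mathcal K}(x)=\{F\in\mathcal K: x\notin F\}$. $\mathcal K$ is vertex decomposable if either $\mathcal K$ is a simplex, or there is a vertex $x$ such that $\mathrm{lk}_{\mathcal K}(x)$ and $\mathrm{del}_{\mathcal K}(x)$ are vertex decomposable and every facet of $\mathrm{del}_{\mathcal K}(x)$ is a facet of $\mathcal K$. -}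

module Defs where

open import Level using (0ℓ)
open import Data.Nat using (ℕ; zero; suc; _+_; _≤_)
open import Data.Fin using (Fin; toℕ)
open import Data.Fin.Subset using (Subset; _∈_; _∉_; _⊆_; ⁅_⁆; _∪_)
open import Data.List using (List; length)
open import Data.List.Relation.Unary.All using (All)
open import Data.List.Relation.Unary.Unique.Propositional using (Unique)
open import Data.Product using (Σ; ∃; _×_; _,_)
open import Data.Sum using (_⊎_)
open import Relation.Binary.PropositionalEquality using (_≡_)

Graph : ℕ → Set₁
Graph n = Fin n → Fin n → Set

Path : (n : ℕ) → Graph n
Path n i j = (suc (toℕ i) ≡ toℕ j) ⊎ (suc (toℕ j) ≡ toℕ i)

data Conn {n : ℕ} (G : Graph n) (A : Subset n) (u : Fin n) : Fin n → Set where
  here : u ∈ A → Conn G A u u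
  step : ∀ {v w} → Conn G A u v → G v w → w ∈ A → Conn G A u w

-- A is r-independent: every connected component of G[A] has at most r
-- vertices, i.e. every list of distinct vertices in the component of any
-- v ∈ A has length ≤ r.
RIndependent : {n : ℕ} → ℕ → Graph n → Subset n → Set
RIndependent r G A =
  ∀ v → v ∈ A → (xs : List _) → Unique xs → All (Conn G A v) xs → length xs ≤ r

Complex : ℕ → Set₁
Complex n = Subset n → Set

Ind : {n : ℕ} → ℕ → Graph n → Complex n
Ind r G = RIndependent r G

lk : {n : ℕ} → Complex n → Fin n → Complex n
lk K x F = x ∉ F × K (F ∪ ⁅ x ⁆)

del : {n : ℕ} → Complex n → Fin n → Complex n
del K x F = x ∉ F × K F

Facet : {n : ℕ} → Complex n → Subset n → Set
Facet K F = K F × (∀ G → K G → F ⊆ G → G ≡ F)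

-- K is a simplex: its faces are exactly the subsets of a single set σ
-- (this includes the complex {∅}).
IsSimplex : {n : ℕ} → Complex n → Set
IsSimplex {n} K = Σ (Subset n) λ σ → ∀ F → (K F → F ⊆ σ) × (F ⊆ σ → K F)

data VertexDecomposable {n : ℕ} (K : Complex n) : Set₁ where
  simplex : IsSimplex K → VertexDecomposable K
  shed    : (x : Fin n) → K ⁅ x ⁆ →
            VertexDecomposable (lk K x) →
            VertexDecomposable (del K x) →
            (∀ F → Facet (del K x) F → Facet K F) →
            VertexDecomposable K

-- A set of vertices of P_n is r-independent iff it contains no r + 1 consecutive vertices.
-- Reading the path from the left while counting the current run c of occupied vertices,
-- links and deletions of such complexes are complexes of the same kind once every vertex
-- carries a status: free, linked (occupied, but never in a face) or deleted (never
-- occupied). If the first r − c vertices and the next vertex x are free, x is a shedding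
-- vertex: its deletion is a cone over those r − c vertices, so every facet of the
-- deletion contains them and cannot be extended by x, while its link makes x linked.
-- Shedding, in the link, the last free vertex before the linked block again and again
-- reduces everything to shorter paths.
module Submission where

open import Defs
open import Data.Bool using (Bool; true; false; f≤t; b≤b)
import Data.Bool as Bool
open import Data.Bool.Properties using (∨-identityʳ)
import Data.Bool.Properties as Boolₚ
open import Data.Empty using (⊥-elim)
open import Data.Fin using (Fin; zero; suc; toℕ; _↑ˡ_; _↑ʳ_)
open import Data.Fin.Properties using (toℕ-injective; toℕ<n) renaming (suc-injective to Fin-suc-injective)
open import Data.Fin.Subset using (Subset; _∈_; _⊆_; ⁅_⁆; _∪_) renaming (⊥ to ∅; ⊤ to full)
open import Data.Fin.Subset.Properties
  using (_∈?_; ⊆⊤; drop-there; drop-∷-⊆; out⊆; s⊆s; ∪-identityʳ; p⊆p∪q; q⊆p∪q; x∈p∪q⁻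
        ; x∈⁅x⁆; x∈⁅y⁆⇒x≡y)
open import Data.Nat using (ℕ; zero; suc; _+_; _∸_; _≤_; _<_; z≤n; s≤s; _≤?_)
open import Data.Nat.Induction using (<-rec)
open import Data.Nat.Properties
open import Data.List using (List; []; _∷_; _++_; length; replicate; map; applyUpTo)
open import Data.List.Extrema ≤-totalOrder using (argmin; argmin-all; f[argmin]≤f[⊤]; f[argmin]≤f[xs])
open import Data.List.Membership.Propositional using () renaming (_∈_ to _∈ˡ_)
open import Data.List.Membership.Propositional.Properties using (∈-∃++; ∈-++⁻; ∈-++⁺ˡ; ∈-++⁺ʳ; ∈-applyUpTo⁺)
open import Data.List.Properties using (length-++-sucʳ; length-map; length-applyUpTo)
open import Data.List.Relation.Unary.All as All using (All; []; _∷_)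
import Data.List.Relation.Unary.All.Properties as Allₚ
import Data.List.Relation.Unary.Any as Any
open import Data.List.Relation.Unary.AllPairs using ([]; _∷_)
open import Data.List.Relation.Unary.Unique.Propositional using (Unique)
import Data.List.Relation.Unary.Unique.Propositional.Properties as Uniqueₚ
open import Data.Product using (∃-syntax; _×_; _,_; proj₁; proj₂)
import Data.Product as Product
open import Data.Sum using (inj₁; inj₂; [_,_])
import Data.Sum as Sum
open import Data.Unit using (⊤; tt)
open import Data.Vec using (_∷_; []; head; tail)
open import Data.Vec.Base using (here; there)
open import Function using (_∘_)
open import Relation.Nullary using (¬_; yes; no)
open import Relation.Binary.PropositionalEquality using (_≡_; _≢_; refl; sym; trans; cong; cong₂; subst; subst₂)
open import Relation.Unary using (_≐_)
open import Relation.Unary.Properties using (≐-refl; ≐-sym; ≐-trans)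

private
  variable
    n : ℕ
    K K′ : Complex n
    v : Fin n
    F : Subset n

-- Complexes and vertex decomposability

DownClosed : Complex n → Set
DownClosed K = ∀ {F G} → G ⊆ F → K F → K G

Facet-resp-≐ : K ≐ K′ → Facet K F → Facet K′ F
Facet-resp-≐ (K⊆K′ , K′⊆K) (KF , maximal) = K⊆K′ KF , λ G K′G F⊆G → maximal G (K′⊆K K′G) F⊆G

lk-resp-≐ : K ≐ K′ → lk K v ≐ lk K′ v
lk-resp-≐ (K⊆K′ , K′⊆K) = Product.map₂ K⊆K′ , Product.map₂ K′⊆K

del-resp-≐ : K ≐ K′ → del K v ≐ del K′ v
del-resp-≐ (K⊆K′ , K′⊆K) = Product.map₂ K⊆K′ , Product.map₂ K′⊆K

VertexDecomposable-resp-≐ : K ≐ K′ → VertexDecomposable K → VertexDecomposable K′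
VertexDecomposable-resp-≐ (K⊆K′ , K′⊆K) (simplex (σ , faces)) =
  simplex (σ , λ F → proj₁ (faces F) ∘ K′⊆K , K⊆K′ ∘ proj₂ (faces F))
VertexDecomposable-resp-≐ K≐K′ (shed x Kx vd-lk vd-del facets) =
  shed x (proj₁ K≐K′ Kx)
    (VertexDecomposable-resp-≐ (lk-resp-≐ K≐K′) vd-lk)
    (VertexDecomposable-resp-≐ (del-resp-≐ K≐K′) vd-del)
    (λ F → Facet-resp-≐ K≐K′ ∘ facets F ∘ Facet-resp-≐ (≐-sym (del-resp-≐ K≐K′)))

del-facet⇒facet : DownClosed K → Facet (del K v) F → ¬ K (F ∪ ⁅ v ⁆) → Facet K F
del-facet⇒facet {K = K} {v = x} {F = F} down ((x∉F , KF) , maximal) ¬K[F∪x] = KF , grow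
  where
  grow : ∀ G → K G → F ⊆ G → G ≡ F
  grow G KG F⊆G with x ∈? G
  ... | no x∉G = maximal G (x∉G , KG) F⊆G
  ... | yes x∈G = ⊥-elim (¬K[F∪x] (down F∪x⊆G KG))
    where
    F∪x⊆G : F ∪ ⁅ x ⁆ ⊆ G
    F∪x⊆G y∈ =
      [ F⊆G , (λ y∈x → subst (_∈ G) (sym (x∈⁅y⁆⇒x≡y x y∈x)) x∈G) ] (x∈p∪q⁻ F ⁅ x ⁆ y∈)

-- prepend true K is the cone over K; prepend false K adds a vertex lying in no face.
prepend : Bool → Complex n → Complex (suc n)
prepend s K (b ∷ F) = b Bool.≤ s × K F

prependⁿ : (k : ℕ) → Bool → Complex n → Complex (k + n)
prependⁿ zero    s K = K
prependⁿ (suc k) s K = prepend s (prependⁿ k s K)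

∷-⊆ : ∀ {b s} {G : Subset n} → b Bool.≤ s → F ⊆ G → (b ∷ F) ⊆ (s ∷ G)
∷-⊆ f≤t F⊆G = out⊆ F⊆G
∷-⊆ b≤b F⊆G = s⊆s F⊆G

∷-⊆⁻ : ∀ {b s} {G : Subset n} → (b ∷ F) ⊆ (s ∷ G) → b Bool.≤ s
∷-⊆⁻ {b = false} {s}     _ = Boolₚ.≤-minimum s
∷-⊆⁻ {b = true}  {true}  _ = b≤b
∷-⊆⁻ {b = true}  {false} bF⊆sG with bF⊆sG here
... | ()

facet-prepend⁺ : ∀ s → Facet K F → Facet (prepend s K) (s ∷ F)
facet-prepend⁺ {K = K} {F = F} s (KF , maximal) = (b≤b , KF) , grow
  where
  grow : ∀ G → prepend s K G → (s ∷ F) ⊆ G → G ≡ s ∷ F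
  grow (b ∷ G) (b≤s , KG) sF⊆bG =
    cong₂ _∷_ (Boolₚ.≤-antisym b≤s (∷-⊆⁻ sF⊆bG)) (maximal G KG (drop-∷-⊆ sF⊆bG))

facet-prepend⁻ : ∀ {s b} → Facet (prepend s K) (b ∷ F) → b ≡ s × Facet K F
facet-prepend⁻ {F = F} {s} {b} ((b≤s , KF) , maximal) =
  sym (cong head (maximal (s ∷ F) (b≤b , KF) (∷-⊆ b≤s (λ y∈ → y∈)))) ,
  (KF , λ G KG F⊆G → cong tail (maximal (b ∷ G) (b≤s , KG) (s⊆s F⊆G)))

lk-prepend : ∀ s → lk (prepend s K) (suc v) ≐ prepend s (lk K v)
lk-prepend {K = K} {v = x} s = to , from
  where
  to : ∀ {F} → lk (prepend s K) (suc x) F → prepend s (lk K x) F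
  to {b ∷ F} (sx∉ , b≤s , K[F∪x]) rewrite ∨-identityʳ b = b≤s , sx∉ ∘ there , K[F∪x]
  from : ∀ {F} → prepend s (lk K x) F → lk (prepend s K) (suc x) F
  from {b ∷ F} (b≤s , x∉ , K[F∪x]) rewrite ∨-identityʳ b = x∉ ∘ drop-there , b≤s , K[F∪x]

del-prepend : ∀ s → del (prepend s K) (suc v) ≐ prepend s (del K v)
del-prepend {K = K} {v = x} s = to , from
  where
  to : ∀ {F} → del (prepend s K) (suc x) F → prepend s (del K x) F
  to {b ∷ F} (sx∉ , b≤s , KF) = b≤s , sx∉ ∘ there , KF
  from : ∀ {F} → prepend s (del K x) F → del (prepend s K) (suc x) F
  from {b ∷ F} (b≤s , x∉ , KF) = x∉ ∘ drop-there , b≤s , KF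

VertexDecomposable-prepend : ∀ s → VertexDecomposable K → VertexDecomposable (prepend s K)
VertexDecomposable-prepend {K = K} s (simplex (σ , faces)) = simplex (s ∷ σ , faces′)
  where
  faces′ : ∀ F → (prepend s K F → F ⊆ s ∷ σ) × (F ⊆ s ∷ σ → prepend s K F)
  faces′ (b ∷ F) = (λ (b≤s , KF) → ∷-⊆ b≤s (proj₁ (faces F) KF)) ,
                   (λ bF⊆sσ → ∷-⊆⁻ bF⊆sσ , proj₂ (faces F) (drop-∷-⊆ bF⊆sσ))
VertexDecomposable-prepend {K = K} s (shed x Kx vd-lk vd-del facets) =
  shed (suc x) (Boolₚ.≤-minimum s , Kx)
    (VertexDecomposable-resp-≐ (≐-sym (lk-prepend s)) (VertexDecomposable-prepend s vd-lk))
    (VertexDecomposable-resp-≐ (≐-sym (del-prepend s)) (VertexDecomposable-prepend s vd-del))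
    facets′
  where
  facets′ : ∀ F → Facet (del (prepend s K) (suc x)) F → Facet (prepend s K) F
  facets′ (b ∷ F) facet with facet-prepend⁻ (Facet-resp-≐ (del-prepend s) facet)
  ... | refl , facetᵈ = facet-prepend⁺ s (facets F facetᵈ)

VertexDecomposable-prependⁿ : ∀ k s → VertexDecomposable K → VertexDecomposable (prependⁿ k s K)
VertexDecomposable-prependⁿ zero    s vd = vd
VertexDecomposable-prependⁿ (suc k) s vd = VertexDecomposable-prepend s (VertexDecomposable-prependⁿ k s vd)

facet-cone-apex : ∀ k {K : Complex n} {F} → Facet (prependⁿ k true K) F → ∀ (j : Fin k) → j ↑ˡ n ∈ F
facet-cone-apex (suc k) {F = b ∷ F} facet j with facet-prepend⁻ facet | j
... | refl , _      | zero  = here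
... | refl , facet′ | suc j = there (facet-cone-apex k facet′ j)

-- Walks and runs in the path

conn-∈ : ∀ {G : Graph n} {A u w} → Conn G A u w → w ∈ A
conn-∈ (here u∈A)     = u∈A
conn-∈ (step _ _ w∈A) = w∈A

conn-trans : ∀ {G : Graph n} {A u v w} → Conn G A u v → Conn G A v w → Conn G A u w
conn-trans u⇝v (here _)         = u⇝v
conn-trans u⇝v (step v⇝w e w∈A) = step (conn-trans u⇝v v⇝w) e w∈A

conn-sym : ∀ {G : Graph n} {A u w} → (∀ {u w} → G u w → G w u) → Conn G A u w → Conn G A w u
conn-sym sym-G (here u∈A)       = here u∈A
conn-sym sym-G (step u⇝v e w∈A) = conn-trans (step (here w∈A) (sym-G e) (conn-∈ u⇝v)) (conn-sym sym-G u⇝v)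

conn-lift : ∀ {A : Subset n} {b u w} → Conn (Path n) A u w → Conn (Path (suc n)) (b ∷ A) (suc u) (suc w)
conn-lift (here u∈A)       = here (there u∈A)
conn-lift (step u⇝v e w∈A) = step (conn-lift u⇝v) (Sum.map (cong suc) (cong suc) e) (there w∈A)

path-edge-below : ∀ {v w : Fin n} {k} → Path n v w → k < toℕ w → k ≤ toℕ v
path-edge-below (inj₁ 1+v≡w) k<w = ≤-pred (subst (_ <_) (sym 1+v≡w) k<w)
path-edge-below (inj₂ 1+w≡v) k<w = <⇒≤ (<-trans k<w (≤-reflexive 1+w≡v))

conn-between : ∀ {A : Subset n} {u w} → Conn (Path n) A u w →
  ∀ j → toℕ u ≤ toℕ j → toℕ j ≤ toℕ w → j ∈ A
conn-between {A = A} (here u∈A) j u≤j j≤u = subst (_∈ A) (toℕ-injective (≤-antisym u≤j j≤u)) u∈A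
conn-between {A = A} (step u⇝v e w∈A) j u≤j j≤w with m≤n⇒m<n∨m≡n j≤w
... | inj₁ j<w = conn-between u⇝v j u≤j (path-edge-below e j<w)
... | inj₂ j≡w = subst (_∈ A) (sym (toℕ-injective j≡w)) w∈A

-- Run A u k: the k + 1 consecutive vertices u, u + 1, …, u + k all lie in A.
data Run : Subset n → Fin n → ℕ → Set where
  single : ∀ {n} {A : Subset n} → Run (true ∷ A) zero 0
  extend : ∀ {n k} {A : Subset (suc n)} → Run A zero k → Run (true ∷ A) zero (suc k)
  shift  : ∀ {n k b u} {A : Subset n} → Run A u k → Run (b ∷ A) (suc u) k

run-head : ∀ {A : Subset n} {u k} → Run A u k → u ∈ A
run-head single     = here
run-head (extend _) = here
run-head (shift ρ)  = there (run-head ρ)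

run-vertices : ∀ {A : Subset n} {u k} → Run A u k → List (Fin n)
run-vertices single     = zero ∷ []
run-vertices (extend ρ) = zero ∷ map suc (run-vertices ρ)
run-vertices (shift ρ)  = map suc (run-vertices ρ)

length-run-vertices : ∀ {A : Subset n} {u k} (ρ : Run A u k) → length (run-vertices ρ) ≡ suc k
length-run-vertices single     = refl
length-run-vertices (extend ρ) = cong suc (trans (length-map suc (run-vertices ρ)) (length-run-vertices ρ))
length-run-vertices (shift ρ)  = trans (length-map suc (run-vertices ρ)) (length-run-vertices ρ)

run-vertices-unique : ∀ {A : Subset n} {u k} (ρ : Run A u k) → Unique (run-vertices ρ)
run-vertices-unique single     = [] ∷ []
run-vertices-unique (extend ρ) =
  Allₚ.map⁺ (All.universal (λ _ ()) (run-vertices ρ)) ∷ Uniqueₚ.map⁺ Fin-suc-injective (run-vertices-unique ρ)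
run-vertices-unique (shift ρ)  = Uniqueₚ.map⁺ Fin-suc-injective (run-vertices-unique ρ)

run-vertices-conn : ∀ {A : Subset n} {u k} (ρ : Run A u k) → All (Conn (Path n) A u) (run-vertices ρ)
run-vertices-conn single     = here here ∷ []
run-vertices-conn {A = true ∷ A} (extend ρ) =
  here here ∷ Allₚ.map⁺ (All.map (conn-trans 0⇝1 ∘ conn-lift) (run-vertices-conn ρ))
  where
  0⇝1 : Conn (Path _) (true ∷ A) zero (suc zero)
  0⇝1 = step (here here) (inj₁ refl) (there (run-head ρ))
run-vertices-conn (shift ρ)  = Allₚ.map⁺ (All.map conn-lift (run-vertices-conn ρ))

interval⇒run : ∀ {A : Subset n} u k → toℕ u + k < n →
  (∀ j → toℕ u ≤ toℕ j → toℕ j ≤ toℕ u + k → j ∈ A) → Run A u k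
interval⇒run {A = b ∷ A} (suc u) k bound inside =
  shift (interval⇒run u k (≤-pred bound) (λ j u≤j j≤ → drop-there (inside (suc j) (s≤s u≤j) (s≤s j≤))))
interval⇒run {A = b ∷ A} zero k bound inside with inside zero z≤n z≤n
interval⇒run {A = true ∷ A}     zero zero    bound    inside | here = single
interval⇒run {A = true ∷ []}    zero (suc k) (s≤s ()) inside | here
interval⇒run {A = true ∷ b ∷ A} zero (suc k) bound    inside | here =
  extend (interval⇒run zero k (≤-pred bound) (λ j _ j≤k → drop-there (inside (suc j) z≤n (s≤s j≤k))))

unique⇒length≤ : ∀ {A : Set} {xs ys : List A} → Unique xs → All (_∈ˡ ys) xs → length xs ≤ length ys
unique⇒length≤ [] [] = z≤n
unique⇒length≤ {xs = x ∷ xs} (x∉xs ∷ unique) (x∈ys ∷ xs⊆ys) with ∈-∃++ x∈ys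
... | ys₁ , ys₂ , refl = subst (suc (length xs) ≤_) (sym (length-++-sucʳ ys₁ x ys₂))
  (s≤s (unique⇒length≤ unique (All.zipWith remove (x∉xs , xs⊆ys))))
  where
  remove : ∀ {z} → x ≢ z × z ∈ˡ ys₁ ++ x ∷ ys₂ → z ∈ˡ ys₁ ++ ys₂
  remove (x≢z , z∈) with ∈-++⁻ ys₁ z∈
  ... | inj₁ z∈ys₁             = ∈-++⁺ˡ z∈ys₁
  ... | inj₂ (Any.here z≡x)    = ⊥-elim (x≢z (sym z≡x))
  ... | inj₂ (Any.there z∈ys₂) = ∈-++⁺ʳ ys₁ z∈ys₂

unique-window : ∀ {lo k} {ns : List ℕ} → Unique ns → All (λ z → lo ≤ z × z < lo + k) ns → length ns ≤ k
unique-window {lo} {k} unique bounded =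
  subst (_ ≤_) (length-applyUpTo (lo +_) k) (unique⇒length≤ unique (All.map in-range bounded))
  where
  in-range : ∀ {z} → lo ≤ z × z < lo + k → z ∈ˡ applyUpTo (lo +_) k
  in-range (lo≤z , z<lo+k) = subst (_∈ˡ applyUpTo (lo +_) k) (m+[n∸m]≡n lo≤z)
    (∈-applyUpTo⁺ (lo +_) (+-cancelˡ-< lo _ k (subst (_< lo + k) (sym (m+[n∸m]≡n lo≤z)) z<lo+k)))

-- Path complexes with vertex statuses

<⇒∃+suc : ∀ {m n} → m < n → ∃[ o ] m + suc o ≡ n
<⇒∃+suc {m} m<n = Product.map₂ (trans (+-suc m _)) (m≤n⇒∃[o]m+o≡n m<n)

replicate-suc-++ : ∀ {A : Set} k (a : A) xs → replicate (suc k) a ++ xs ≡ replicate k a ++ a ∷ xs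
replicate-suc-++ zero    a xs = refl
replicate-suc-++ (suc k) a xs = cong (a ∷_) (replicate-suc-++ k a xs)

data Status : Set where
  free linked deleted : Status

-- A status list describes the path from the left; the vertices beyond its end are free.
head₀ : List Status → Status
head₀ []      = free
head₀ (s ∷ _) = s

tail₀ : List Status → List Status
tail₀ []       = []
tail₀ (_ ∷ ss) = ss

module _ (r : ℕ) where

  -- Step s b c c′: after a run of c occupied vertices, a vertex of status s that is (b) or
  -- is not in the face leaves a run of c′; chosen and linked vertices are occupied.
  data Step : Status → Bool → ℕ → ℕ → Set where
    take : ∀ {c} → c < r → Step free    true  c (suc c)
    skip : ∀ {c} →         Step free    false c 0
    hold : ∀ {c} → c < r → Step linked  false c (suc c)
    cut  : ∀ {c} →         Step deleted false c 0

  Δ : List Status → ℕ → Complex n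
  Δ ss c []      = ⊤
  Δ ss c (b ∷ F) = ∃[ c′ ] Step (head₀ ss) b c c′ × Δ (tail₀ ss) c′ F

  step-mono : ∀ {s b b′ c c′ d} → Step s b c d → b′ Bool.≤ b → c′ ≤ c →
    ∃[ d′ ] d′ ≤ d × Step s b′ c′ d′
  step-mono (take c<r) b≤b c′≤c = _ , s≤s c′≤c , take (≤-<-trans c′≤c c<r)
  step-mono (take c<r) f≤t c′≤c = _ , z≤n , skip
  step-mono skip       b≤b c′≤c = _ , z≤n , skip
  step-mono (hold c<r) b≤b c′≤c = _ , s≤s c′≤c , hold (≤-<-trans c′≤c c<r)
  step-mono cut        b≤b c′≤c = _ , z≤n , cut

  Δ-mono : ∀ ss {c c′} {F G : Subset n} → c′ ≤ c → G ⊆ F → Δ ss c F → Δ ss c′ G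
  Δ-mono ss {F = []}    {[]}     _    _   _ = tt
  Δ-mono ss {F = b ∷ F} {b′ ∷ G} c′≤c G⊆F (d , st , t) with step-mono st (∷-⊆⁻ G⊆F) c′≤c
  ... | d′ , d′≤d , st′ = d′ , st′ , Δ-mono (tail₀ ss) d′≤d (drop-∷-⊆ G⊆F) t

  Δ-downClosed : ∀ ss c → DownClosed (Δ {n} ss c)
  Δ-downClosed ss c = Δ-mono ss ≤-refl

  Δ-lk-at : ∀ i L c →
    lk (Δ {i + suc n} (replicate i free ++ free ∷ L) c) (i ↑ʳ zero) ≐ Δ (replicate i free ++ linked ∷ L) c
  Δ-lk-at zero L c = to , from
    where
    to : ∀ {F} → lk (Δ (free ∷ L) c) zero F → Δ (linked ∷ L) c F
    to {true ∷ F}  (0∉F , _)              = ⊥-elim (0∉F here)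
    to {false ∷ F} (_ , _ , take c<r , t) = _ , hold c<r , subst (Δ L (suc c)) (∪-identityʳ F) t
    from : ∀ {F} → Δ (linked ∷ L) c F → lk (Δ (free ∷ L) c) zero F
    from {false ∷ F} (_ , hold c<r , t) = (λ ()) , _ , take c<r , subst (Δ L (suc c)) (sym (∪-identityʳ F)) t
  Δ-lk-at (suc i) L c = to , from
    where
    to : ∀ {F} → lk (Δ (replicate (suc i) free ++ free ∷ L) c) (suc i ↑ʳ zero) F →
         Δ (replicate (suc i) free ++ linked ∷ L) c F
    to {b ∷ F} (x∉ , d , st , t) rewrite ∨-identityʳ b = d , st , proj₁ (Δ-lk-at i L d) (x∉ ∘ there , t)
    from : ∀ {F} → Δ (replicate (suc i) free ++ linked ∷ L) c F →
           lk (Δ (replicate (suc i) free ++ free ∷ L) c) (suc i ↑ʳ zero) F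
    from {b ∷ F} (d , st , t) rewrite ∨-identityʳ b with proj₂ (Δ-lk-at i L d) t
    ... | x∉ , t′ = x∉ ∘ drop-there , d , st , t′

  Δ-del-at : ∀ i L c →
    del (Δ {i + suc n} (replicate i free ++ free ∷ L) c) (i ↑ʳ zero) ≐ Δ (replicate i free ++ deleted ∷ L) c
  Δ-del-at zero L c = to , from
    where
    to : ∀ {F} → del (Δ (free ∷ L) c) zero F → Δ (deleted ∷ L) c F
    to {true ∷ F}  (0∉F , _)          = ⊥-elim (0∉F here)
    to {false ∷ F} (_ , _ , skip , t) = _ , cut , t
    from : ∀ {F} → Δ (deleted ∷ L) c F → del (Δ (free ∷ L) c) zero F
    from {false ∷ F} (_ , cut , t) = (λ ()) , _ , skip , t
  Δ-del-at (suc i) L c = to , from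
    where
    to : ∀ {F} → del (Δ (replicate (suc i) free ++ free ∷ L) c) (suc i ↑ʳ zero) F →
         Δ (replicate (suc i) free ++ deleted ∷ L) c F
    to {b ∷ F} (x∉ , d , st , t) = d , st , proj₁ (Δ-del-at i L d) (x∉ ∘ there , t)
    from : ∀ {F} → Δ (replicate (suc i) free ++ deleted ∷ L) c F →
           del (Δ (replicate (suc i) free ++ free ∷ L) c) (suc i ↑ʳ zero) F
    from {b ∷ F} (d , st , t) with proj₂ (Δ-del-at i L d) t
    ... | x∉ , t′ = x∉ ∘ drop-there , d , st , t′

  Δ-free-deleted : ∀ i {n} {L} c → i + c ≤ r →
    Δ {i + suc n} (replicate i free ++ deleted ∷ L) c ≐ prependⁿ i true (prepend false (Δ L 0))
  Δ-free-deleted zero {L = L} c _ = to , from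
    where
    to : ∀ {F} → Δ (deleted ∷ L) c F → prepend false (Δ L 0) F
    to {false ∷ F} (_ , cut , t) = b≤b , t
    from : ∀ {F} → prepend false (Δ L 0) F → Δ (deleted ∷ L) c F
    from {false ∷ F} (_ , t) = _ , cut , t
  Δ-free-deleted (suc i) {n} {L} c 1+i+c≤r = to , from
    where
    Cone : Complex (i + suc n)
    Cone = prependⁿ i true (prepend false (Δ L 0))
    occupied : Δ (replicate i free ++ deleted ∷ L) (suc c) ≐ Cone
    occupied = Δ-free-deleted i (suc c) (subst (_≤ r) (sym (+-suc i c)) 1+i+c≤r)
    vacant : Δ (replicate i free ++ deleted ∷ L) 0 ≐ Cone
    vacant = Δ-free-deleted i 0 (≤-trans (+-monoʳ-≤ i z≤n) (<⇒≤ 1+i+c≤r))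
    to : ∀ {F} → Δ (replicate (suc i) free ++ deleted ∷ L) c F → prepend true Cone F
    to {true ∷ F}  (_ , take _ , t) = b≤b , proj₁ occupied t
    to {false ∷ F} (_ , skip , t)   = f≤t , proj₁ vacant t
    from : ∀ {F} → prepend true Cone F → Δ (replicate (suc i) free ++ deleted ∷ L) c F
    from {true ∷ F}  (_ , t) = _ , take (≤-<-trans (m≤n+m c i) 1+i+c≤r) , proj₂ occupied t
    from {false ∷ F} (_ , t) = _ , skip , proj₂ vacant t

  Δ-linked : ∀ b {n} c → b + c ≤ r → Δ {b + n} (replicate b linked) c ≐ prependⁿ b false (Δ [] (b + c))
  Δ-linked zero    c _       = ≐-refl
  Δ-linked (suc b) {n} c 1+b+c≤r = to , from
    where
    Ghosts : ℕ → Complex (b + n)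
    Ghosts d = prependⁿ b false (Δ [] d)
    occupied : Δ (replicate b linked) (suc c) ≐ Ghosts (b + suc c)
    occupied = Δ-linked b (suc c) (subst (_≤ r) (sym (+-suc b c)) 1+b+c≤r)
    to : ∀ {F} → Δ (replicate (suc b) linked) c F → prepend false (Ghosts (suc b + c)) F
    to {false ∷ F} (_ , hold _ , t) = b≤b , subst (λ d → Ghosts d F) (+-suc b c) (proj₁ occupied t)
    from : ∀ {F} → prepend false (Ghosts (suc b + c)) F → Δ (replicate (suc b) linked) c F
    from {false ∷ F} (_ , p) =
      _ , hold (≤-<-trans (m≤n+m c b) 1+b+c≤r) , proj₂ occupied (subst (λ d → Ghosts d F) (sym (+-suc b c)) p)

  Δ-linked-∅ : ∀ b {n} c → b + c ≤ r → Δ {n} (replicate b linked) c ∅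
  Δ-linked-∅ b       {zero}  c _       = tt
  Δ-linked-∅ zero    {suc n} c _       = _ , skip , Δ-linked-∅ 0 0 z≤n
  Δ-linked-∅ (suc b) {suc n} c 1+b+c≤r =
    _ , hold (≤-<-trans (m≤n+m c b) 1+b+c≤r) , Δ-linked-∅ b (suc c) (subst (_≤ r) (sym (+-suc b c)) 1+b+c≤r)

  linked-overflow : ∀ b {n} c {F : Subset (suc b + n)} → r ≤ b + c → ¬ Δ (replicate (suc b) linked) c F
  linked-overflow zero    c {false ∷ F} r≤c   (_ , hold c<r , _) = <⇒≱ c<r r≤c
  linked-overflow (suc b) c {false ∷ F} r≤b+c (_ , hold _ , t)   =
    linked-overflow b (suc c) (subst (r ≤_) (sym (+-suc b c)) r≤b+c) t

  take⇒hold : ∀ {L c} {F : Subset n} → Δ (free ∷ L) c (true ∷ F) → Δ (linked ∷ L) c (false ∷ F)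
  take⇒hold (_ , take c<r , t) = _ , hold c<r , t

  Δ-dead : ∀ {L c} → (∀ {F} → ¬ Δ {suc n} (free ∷ L) c (true ∷ F)) →
    Δ (free ∷ L) c ≐ prepend false (Δ L 0)
  Δ-dead {n} {L} {c} dead = to , from
    where
    to : ∀ {F : Subset (suc n)} → Δ (free ∷ L) c F → prepend false (Δ L 0) F
    to {true ∷ F}  t              = ⊥-elim (dead t)
    to {false ∷ F} (_ , skip , t) = b≤b , t
    from : ∀ {F : Subset (suc n)} → prepend false (Δ L 0) F → Δ (free ∷ L) c F
    from {false ∷ F} (_ , t) = _ , skip , t

  Δ-overflow : ∀ i {n} {L} c → (∀ {F} → ¬ Δ {suc n} (free ∷ L) (i + c) (true ∷ F)) →
    ∀ {G} → (∀ j → j ↑ˡ suc n ∈ G) → i ↑ʳ zero ∈ G → ¬ Δ (replicate i free ++ free ∷ L) c G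
  Δ-overflow zero    c overflow {true ∷ G} _ here t = overflow t
  Δ-overflow (suc i) {n} {L} c overflow {b ∷ G} prefix x∈G t with prefix zero | t
  ... | here | (_ , take _ , t′) =
    Δ-overflow i (suc c) overflow′ (drop-there ∘ prefix ∘ suc) (drop-there x∈G) t′
    where
    overflow′ : ∀ {F : Subset n} → ¬ Δ (free ∷ L) (i + suc c) (true ∷ F)
    overflow′ = subst (λ d → ∀ {F : Subset n} → ¬ Δ (free ∷ L) d (true ∷ F)) (sym (+-suc i c)) overflow

  Δ-singleton : ∀ i {n} {L} → Δ {suc n} (free ∷ L) 0 ⁅ zero ⁆ →
    Δ (replicate i free ++ free ∷ L) 0 ⁅ i ↑ʳ zero {n} ⁆
  Δ-singleton zero    t = t
  Δ-singleton (suc i) t = _ , skip , Δ-singleton i t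

  Δ-full : ∀ {n} c → n + c ≤ r → ∀ F → Δ {n} [] c F
  Δ-full c _ [] = tt
  Δ-full {suc n} c 1+n+c≤r (true ∷ F) =
    _ , take (≤-<-trans (m≤n+m c n) 1+n+c≤r) , Δ-full (suc c) (subst (_≤ r) (sym (+-suc n c)) 1+n+c≤r) F
  Δ-full {suc n} c 1+n+c≤r (false ∷ F) =
    _ , skip , Δ-full 0 (≤-trans (+-monoʳ-≤ n z≤n) (<⇒≤ 1+n+c≤r)) F

  Δ-padding : ∀ i {n} c → Δ {n} (replicate i free ++ free ∷ []) c ≐ Δ [] c
  Δ-padding i c = to i , from i
    where
    to : ∀ i {n c} {F : Subset n} → Δ (replicate i free ++ free ∷ []) c F → Δ [] c F
    to i       {F = []}    t            = tt
    to zero    {F = b ∷ F} t            = t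
    to (suc i) {F = b ∷ F} (d , st , t) = d , st , to i t
    from : ∀ i {n c} {F : Subset n} → Δ [] c F → Δ (replicate i free ++ free ∷ []) c F
    from i       {F = []}    t            = tt
    from zero    {F = b ∷ F} t            = t
    from (suc i) {F = b ∷ F} (d , st , t) = d , st , from i t

  Δ-vd-shed : ∀ i {n} L c → i + c ≤ r →
    (∀ {F} → ¬ Δ {suc n} (free ∷ L) (i + c) (true ∷ F)) →
    Δ (replicate i free ++ free ∷ L) c ⁅ i ↑ʳ zero {n} ⁆ →
    VertexDecomposable (Δ {i + suc n} (replicate i free ++ linked ∷ L) c) →
    VertexDecomposable (Δ {n} L 0) →
    VertexDecomposable (Δ {i + suc n} (replicate i free ++ free ∷ L) c)
  Δ-vd-shed i {n} L c i+c≤r overflow singleton vd-lk vd-L =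
    shed x singleton
      (VertexDecomposable-resp-≐ (≐-sym (Δ-lk-at i L c)) vd-lk)
      (VertexDecomposable-resp-≐ (≐-sym del≐cone)
        (VertexDecomposable-prependⁿ i true (VertexDecomposable-prepend false vd-L)))
      facets
    where
    x : Fin (i + suc n)
    x = i ↑ʳ zero
    K₀ : Complex (i + suc n)
    K₀ = Δ (replicate i free ++ free ∷ L) c
    del≐cone : del K₀ x ≐ prependⁿ i true (prepend false (Δ L 0))
    del≐cone = ≐-trans (Δ-del-at i L c) (Δ-free-deleted i c i+c≤r)
    facets : ∀ F → Facet (del K₀ x) F → Facet K₀ F
    facets F facet = del-facet⇒facet (Δ-downClosed _ c) facet
      (Δ-overflow i c overflow (λ j → p⊆p∪q ⁅ x ⁆ (prefix j)) (q⊆p∪q F ⁅ x ⁆ (x∈⁅x⁆ x)))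
      where
      prefix : ∀ j → j ↑ˡ suc n ∈ F
      prefix = facet-cone-apex i (Facet-resp-≐ del≐cone facet)

  Δ-vd-linked : ∀ b {m} c → b + c ≤ r → (∀ c′ → c′ ≤ r → VertexDecomposable (Δ {m} [] c′)) →
    VertexDecomposable (Δ {b + m} (replicate b linked) c)
  Δ-vd-linked b c b+c≤r vd-free =
    VertexDecomposable-resp-≐ (≐-sym (Δ-linked b c b+c≤r))
      (VertexDecomposable-prependⁿ b false (vd-free (b + c) b+c≤r))

  Δ-vd-free-linked : ∀ i b c {m} → b + (i + c) ≡ r →
    (∀ c′ → c′ ≤ r → VertexDecomposable (Δ {m} [] c′)) →
    VertexDecomposable (Δ {i + suc (b + m)} (replicate i free ++ free ∷ replicate b linked) c)
  Δ-vd-free-linked zero b c b+c≡r vd-free =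
    VertexDecomposable-resp-≐ (≐-sym (Δ-dead dead))
      (VertexDecomposable-prepend false (Δ-vd-linked b 0 (≤-trans (+-monoʳ-≤ b z≤n) (≤-reflexive b+c≡r)) vd-free))
    where
    dead : ∀ {F} → ¬ Δ (free ∷ replicate b linked) c (true ∷ F)
    dead = linked-overflow b c (≤-reflexive (sym b+c≡r)) ∘ take⇒hold
  Δ-vd-free-linked (suc k) b c {m} b+1+k+c≡r vd-free =
    Δ-vd-shed (suc k) (replicate b linked) c (≤-trans (m≤n+m _ b) (≤-reflexive b+1+k+c≡r)) overflow singleton vd-lk
      (Δ-vd-linked b 0 (≤-trans (+-monoʳ-≤ b z≤n) (≤-reflexive b+1+k+c≡r)) vd-free)
    where
    b+1≤r : b + 1 ≤ r
    b+1≤r = ≤-trans (+-monoʳ-≤ b (s≤s z≤n)) (≤-reflexive b+1+k+c≡r)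
    overflow : ∀ {F} → ¬ Δ (free ∷ replicate b linked) (suc k + c) (true ∷ F)
    overflow = linked-overflow b (suc k + c) (≤-reflexive (sym b+1+k+c≡r)) ∘ take⇒hold
    singleton : Δ (replicate (suc k) free ++ free ∷ replicate b linked) c ⁅ suc k ↑ʳ zero {b + m} ⁆
    singleton = _ , skip , Δ-singleton k (_ , take (≤-trans (m≤n+m 1 b) b+1≤r) , Δ-linked-∅ b 1 b+1≤r)
    vd-lk : VertexDecomposable (Δ {suc k + suc (b + m)} (replicate (suc k) free ++ linked ∷ replicate b linked) c)
    vd-lk = subst₂ (λ n ss → VertexDecomposable (Δ {n} ss c))
      (+-suc k (suc (b + m))) (sym (replicate-suc-++ k free (linked ∷ replicate b linked)))
      (Δ-vd-free-linked k (suc b) c (trans (sym (+-suc b (k + c))) b+1+k+c≡r) vd-free)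

  Δ-vd-free : ∀ m c → c ≤ r → VertexDecomposable (Δ {m} [] c)
  Δ-vd-free = <-rec _ from-shorter
    where
    from-shorter : ∀ m → (∀ {m′} → m′ < m → ∀ c → c ≤ r → VertexDecomposable (Δ {m′} [] c)) →
      ∀ c → c ≤ r → VertexDecomposable (Δ {m} [] c)
    from-shorter m rec c c≤r with m ≤? r ∸ c
    ... | yes m≤r∸c = simplex (full , λ F → (λ _ → ⊆⊤) , λ _ → Δ-full c m+c≤r F)
      where
      m+c≤r : m + c ≤ r
      m+c≤r = ≤-trans (+-monoˡ-≤ c m≤r∸c) (≤-reflexive (m∸n+n≡m c≤r))
    ... | no m≰r∸c with <⇒∃+suc (≰⇒> m≰r∸c)
    ...   | m′ , refl = VertexDecomposable-resp-≐ (Δ-padding (r ∸ c) c)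
      (Δ-vd-free-linked (r ∸ c) 0 c (m∸n+n≡m c≤r) (rec (m≤n+m (suc m′) (r ∸ c))))

  -- Ind_r(P_n) as a path complex

  Δ-initial-run : ∀ {c k} {A : Subset (suc n)} → Δ [] c A → Run A zero k → k + c < r
  Δ-initial-run (_ , take c<r , _) single = c<r
  Δ-initial-run {c = c} {suc k} (_ , take _ , t) (extend ρ) = subst (_< r) (+-suc k c) (Δ-initial-run t ρ)

  Δ-run : ∀ {c u k} {A : Subset n} → Δ [] c A → Run A u k → k < r
  Δ-run             t           single     = m+n≤o⇒m≤o 1 (Δ-initial-run t single)
  Δ-run {k = suc k} t           (extend ρ) = m+n≤o⇒m≤o (suc (suc k)) (Δ-initial-run t (extend ρ))
  Δ-run             (_ , _ , t) (shift ρ)  = Δ-run t ρ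

  short-runs⇒Δ : ∀ {c} {A : Subset n} → (∀ {u k} → Run A u k → k < r) →
    (∀ {u k} → toℕ u ≡ 0 → Run A u k → k + c < r) → Δ [] c A
  short-runs⇒Δ {A = []} short initial = tt
  short-runs⇒Δ {c = c} {true ∷ A} short initial =
    _ , take (initial refl single) , short-runs⇒Δ (short ∘ shift) initial′
    where
    initial′ : ∀ {u k} → toℕ u ≡ 0 → Run A u k → k + suc c < r
    initial′ {zero} {k} _ ρ = subst (_< r) (sym (+-suc k c)) (initial refl (extend ρ))
  short-runs⇒Δ {A = false ∷ A} short initial =
    _ , skip , short-runs⇒Δ (short ∘ shift) (λ {_} {k} _ ρ → subst (_< r) (sym (+-identityʳ k)) (short (shift ρ)))

  Ind⇒short-runs : ∀ {A : Subset n} {u k} → Ind r (Path n) A → Run A u k → k < r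
  Ind⇒short-runs ind ρ = subst (_≤ r) (length-run-vertices ρ)
    (ind _ (run-head ρ) (run-vertices ρ) (run-vertices-unique ρ) (run-vertices-conn ρ))

  -- The walk from the leftmost listed vertex to any other listed vertex covers the run
  -- between them, so all of them lie in a window of width r.
  Δ⇒Ind : ∀ {A : Subset n} → Δ [] 0 A → Ind r (Path n) A
  Δ⇒Ind t v _ []       _      _           = z≤n
  Δ⇒Ind {n} {A} t v _ (x ∷ xs) unique (v⇝x ∷ v⇝xs) =
    subst (_≤ r) (length-map toℕ (x ∷ xs))
      (unique-window (Uniqueₚ.map⁺ toℕ-injective unique) (Allₚ.map⁺ (All.zipWith window (left≤ , v⇝x ∷ v⇝xs))))
    where
    left : Fin n
    left = argmin toℕ x xs
    v⇝left : Conn (Path n) A v left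
    v⇝left = argmin-all toℕ v⇝x v⇝xs
    left≤ : All (λ y → toℕ left ≤ toℕ y) (x ∷ xs)
    left≤ = f[argmin]≤f[⊤] {f = toℕ} x xs ∷ f[argmin]≤f[xs] {f = toℕ} x xs
    window : ∀ {y} → toℕ left ≤ toℕ y × Conn (Path n) A v y → toℕ left ≤ toℕ y × toℕ y < toℕ left + r
    window {y} (left≤y , v⇝y) =
      left≤y , subst (_< toℕ left + r) left+[y∸left]≡y (+-monoʳ-< (toℕ left) (Δ-run t ρ))
      where
      left+[y∸left]≡y : toℕ left + (toℕ y ∸ toℕ left) ≡ toℕ y
      left+[y∸left]≡y = m+[n∸m]≡n left≤y
      ρ : Run A left (toℕ y ∸ toℕ left)
      ρ = interval⇒run left _ (subst (_< n) (sym left+[y∸left]≡y) (toℕ<n y)) λ j left≤j j≤ →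
        conn-between (conn-trans (conn-sym Sum.swap v⇝left) v⇝y) j left≤j (subst (toℕ j ≤_) left+[y∸left]≡y j≤)

  Ind≐Δ : Ind r (Path n) ≐ Δ [] 0
  Ind≐Δ = Ind⇒Δ , Δ⇒Ind
    where
    Ind⇒Δ : ∀ {A : Subset n} → Ind r (Path n) A → Δ [] 0 A
    Ind⇒Δ ind = short-runs⇒Δ (Ind⇒short-runs ind)
      (λ {_} {k} _ ρ → subst (_< r) (sym (+-identityʳ k)) (Ind⇒short-runs ind ρ))

corollary3p14 : (n r : ℕ) → 1 ≤ n → 1 ≤ r → VertexDecomposable (Ind r (Path n))
corollary3p14 n r _ _ = VertexDecomposable-resp-≐ (≐-sym (Ind≐Δ r)) (Δ-vd-free r n 0 z≤n)
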